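{- Let $\mathbb S$ be the factorial association scheme with parameters $u_1,\dots,u_n$, let $n_2=|\{a:u_a>2\}|$ and $d_1=|\mathrm O_\vartheta(\mathbb S)|$. Then the number of closed subsets of $\mathbb S$ equals $2^{n_2}G_2(\log_2d_1)$, and the number of strongly normal closed subsets of $\mathbb S$ equals $G_2(\log_2 d_1)$.
   Context: Let $n\ge1$ and let $\mathbb U_1,\dots,\mathbb U_n$ be finite sets with $|\mathbb U_a|=u_a\ge2$. Put $\mathbb X=\prod_a\mathbb U_a$, $d=2^n-1$. For $g\in[0,d]$ with binary expansion $g=\sum_{a=1}^n g_{(a)}2^{a-1}$ let $\mathbb P(g)=\{a:g_{(a)}=1\}$. Let $R_g=\{(\mathbf u,\mathbf v)\in\mathbb X^2:\mathbf u_a\ne\mathbf v_a\iff a\in\mathbb P(g)\}$, $\mathbb S=\{R_0,\dots,R_d\}$. For $(\mathbf u,\mathbf v)\in R_i$ let $p_{gh}^i=|\{\mathbf w:(\mathbf u,\mathbf w)\in R_g,(\mathbf w,\mathbf v)\in R_h\}|$ and $k_g=|\{\mathbf w:(\mathbf u,\mathbf w)\in R_g\}|$. For nonempty $\mathbb A,\mathbb B\subseteq\mathbb S$, $\mathbb A\mathbb B=\{R_a:\exists R_b\in\mathbb A,R_c\in\mathbb B,\ p_{bc}^a>0\}$. A nonempty $\mathbb A\subseteq\mathbb S$ is closed if $\mathbb A\mathbb A\subseteq\mathbb A$; a closed $\mathbb A$ is strongly normal in $\mathbb S$ if $\{R_g\}\mathbb A\{R_g\}\subseteq\mathbb A$ for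 all $R_g\in\mathbb S$. $\mathrm O_\vartheta(\mathbb S)=\{R_a:k_a=1\}$. For $m\in\mathbb N_0$, $G_2(m)$ (Galois number) is the number of subspaces of an $m$-dimensional vector space over the field with two elements. -}

module Defs where

open import Data.Bool using (Bool; true; false; _∧_; _∨_; not; if_then_else_; _xor_)
open import Data.Nat using (ℕ; zero; suc; _^_; _≤_; _<ᵇ_; _≡ᵇ_; _/_; _%_; z≤n; s≤s)
open import Data.Nat.Properties using (≤-trans)
open import Data.Fin using (Fin; toℕ; fromℕ<; _≟_)
import Data.Fin as F
import Data.Bool as B
open import Data.List using (List; []; _∷_; [_]; map; _++_; concatMap; filter; length; allFin; null)
open import Data.Bool.ListAction using (all; any)
open import Data.Vec using (Vec; replicate; zipWith)
import Data.Vec as V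
open import Function using (_∘_)
open import Relation.Nullary.Decidable using (⌊_⌋)

sublists : {A : Set} → List A → List (List A)
sublists [] = [ [] ]
sublists (x ∷ xs) = let r = sublists xs in map (x ∷_) r ++ r

countL : {A : Set} → (A → Bool) → List A → ℕ
countL p xs = length (filter (λ x → p x B.≟ true) xs)

-- Galois number G₂(m): number of subspaces of 𝔽₂^m (𝔽₂ = Bool, + = xor)

allVecs : (m : ℕ) → List (Vec Bool m)
allVecs zero = [ V.[] ]
allVecs (suc m) = concatMap (λ b → map (b V.∷_) (allVecs m)) (true ∷ false ∷ [])

eqVec : {m : ℕ} → Vec Bool m → Vec Bool m → Bool
eqVec V.[] V.[] = true
eqVec (x V.∷ xs) (y V.∷ ys) = not (x xor y) ∧ eqVec xs ys

memVec : {m : ℕ} → Vec Bool m → List (Vec Bool m) → Bool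
memVec x S = any (eqVec x) S

-- a subset of 𝔽₂^m is a subspace iff it contains 0 and is closed under +
-- (closure under scalar multiplication by 0 or 1 is then automatic)
isSubspace : {m : ℕ} → List (Vec Bool m) → Bool
isSubspace {m} S =
  memVec (replicate m false) S ∧
  all (λ x → all (λ y → memVec (zipWith _xor_ x y) S) S) S

G₂ : ℕ → ℕ
G₂ m = countL isSubspace (sublists (allVecs m))

-- The factorial association scheme with parameters u : Fin n → ℕ, u a ≥ 2.
-- Coordinate a ranges over 𝕌_a = Fin (u a) (0-indexed: a : Fin n).

Point : (n : ℕ) → (Fin n → ℕ) → Set
Point n u = (a : Fin n) → Fin (u a)

cons : {n : ℕ} {u : Fin (suc n) → ℕ} → Fin (u F.zero) → Point n (u ∘ F.suc) → Point (suc n) u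
cons x f F.zero = x
cons x f (F.suc a) = f a

points : (n : ℕ) (u : Fin n → ℕ) → List (Point n u)
points zero u = [ (λ ()) ]
points (suc n) u = concatMap (λ x → map (cons x) (points n (u ∘ F.suc))) (Data.List.allFin (u F.zero))

-- relation indices g ∈ [0, d], d = 2^n - 1
Idx : ℕ → Set
Idx n = Fin (2 ^ n)

-- g_(a) : the a-th binary digit of g, i.e. ⌊g / 2^a⌋ mod 2
-- (a 0-indexed here; the paper's digit a+1)
bit : ℕ → ℕ → ℕ
bit g zero = g % 2
bit g (suc a) = bit (g / 2) a

inP : {n : ℕ} → Idx n → Fin n → Bool
inP g a = bit (toℕ g) (toℕ a) ≡ᵇ 1

-- (u , v) ∈ R_g  iff  ∀ a, (u_a ≠ v_a ⇔ a ∈ ℙ(g))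
inR : {n : ℕ} {u : Fin n → ℕ} → Idx n → Point n u → Point n u → Bool
inR {n} g x y = all (λ a → not (not ⌊ x a ≟ y a ⌋ xor inP g a)) (Data.List.allFin n)

module Scheme (n : ℕ) (u : Fin n → ℕ) (h : (a : Fin n) → 2 ≤ u a) where

  𝕏 : List (Point n u)
  𝕏 = points n u

  -- fixed base point 𝐮₀ = (0,…,0) and, for each i, a representative
  -- (𝐮₀ , rep i) ∈ R_i  (rep i has coordinate 1 exactly on ℙ(i))
  base : Point n u
  base a = fromℕ< {0} (≤-trans (s≤s z≤n) (h a))

  rep : Idx n → Point n u
  rep i a = if inP i a then fromℕ< {1} (h a) else base a

  -- intersection numbers p_{gh}^i, computed at the pair (base , rep i) ∈ R_i
  p : Idx n → Idx n → Idx n → ℕ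
  p g h' i = countL (λ w → inR g base w ∧ inR h' w (rep i)) 𝕏

  k : Idx n → ℕ
  k g = countL (λ w → inR g base w) 𝕏

  -- 𝕊 = {R_0,…,R_d}, identified with its index list
  𝕊 : List (Idx n)
  𝕊 = Data.List.allFin (2 ^ n)

  memS : Idx n → List (Idx n) → Bool
  memS x A = any (λ y → ⌊ x ≟ y ⌋) A

  inProd : List (Idx n) → List (Idx n) → Idx n → Bool
  inProd A B a = any (λ b → any (λ c → 0 <ᵇ p b c a) B) A

  sub : List (Idx n) → List (Idx n) → Bool
  sub A B = all (λ x → memS x B) A

  prod : List (Idx n) → List (Idx n) → List (Idx n)
  prod A B = filter (λ a → inProd A B a B.≟ true) 𝕊

  isClosed : List (Idx n) → Bool
  isClosed A = not (null A) ∧ sub (prod A A) A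

  isStronglyNormal : List (Idx n) → Bool
  isStronglyNormal A = isClosed A ∧ all (λ g → sub (prod (prod [ g ] A) [ g ]) A) 𝕊

  numClosed : ℕ
  numClosed = countL isClosed (sublists 𝕊)

  numStronglyNormal : ℕ
  numStronglyNormal = countL isStronglyNormal (sublists 𝕊)

  n₂ : ℕ
  n₂ = countL (λ a → 2 <ᵇ u a) (Data.List.allFin n)

  -- d₁ = |O_ϑ(𝕊)| = |{R_a : k_a = 1}|
  d₁ : ℕ
  d₁ = countL (λ g → k g ≡ᵇ 1) 𝕊

{-# OPTIONS --safe #-}
module Submission where

-- Identify R_g with the set ℙ(g) of coordinates in which related points differ.
-- Relations compose coordinatewise: p_{bc}^a > 0 iff in every coordinate j either
-- (j ∈ ℙ(a)) = (j ∈ ℙ(b)) xor (j ∈ ℙ(c)), or u_j > 2 and j ∈ ℙ(b) ∩ ℙ(c).  Call j big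
-- if u_j > 2 and binary if u_j = 2.  A closed subset 𝔸 thus contains R_0, is closed
-- under symmetric difference on the binary coordinates, and absorbs any big
-- coordinates inside its support.  Hence 𝔸 is determined by the set s of big
-- coordinates it meets and the set V of binary parts of its members, an
-- 𝔽₂-subspace; conversely every pair (s, V) gives the closed subset
-- Φ s V = {g : ℙ(g) ∩ big ⊆ s, ℙ(g) ∩ binary ∈ V}.  A strongly normal closed subset
-- contains R_big ∈ R_big R_0 R_big, so s = big, and every Φ big V is strongly normal.
-- Finally k_g = ∏_{j ∈ ℙ(g)} (u_j - 1), so O_ϑ(𝕊) = {g : ℙ(g) ⊆ binary} and
-- d₁ = 2^|binary|, while n₂ = |big|.

open import Data.Bool using (Bool; true; false; _∧_; _∨_; not; _xor_; if_then_else_)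
import Data.Bool as B
import Data.Bool.Properties as BP
open import Data.Bool.ListAction using (all; any)
open import Data.Empty using (⊥-elim)
open import Data.Fin using (Fin; toℕ; fromℕ<)
import Data.Fin as F
import Data.Fin.Properties as FP
open import Data.List using (List; []; _∷_; [_]; _++_; map; filter; length; concatMap; tabulate; allFin; null; cartesianProduct)
import Data.List.Properties as LP
open import Data.List.Membership.Propositional using (_∈_)
import Data.List.Membership.Propositional.Properties as MP
open import Data.List.Relation.Binary.Subset.Propositional using (_⊆_)
open import Data.List.Relation.Unary.Any using (here; there)
import Data.List.Relation.Unary.All as All
import Data.List.Relation.Unary.All.Properties as AllP
import Data.List.Relation.Unary.AllPairs as AP
open import Data.List.Relation.Unary.Unique.Propositional using (Unique)
import Data.List.Relation.Unary.Unique.Propositional.Properties as UP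
open import Data.Nat using (ℕ; zero; suc; _+_; _*_; _^_; _≤_; _<_; _<ᵇ_; _≡ᵇ_; _/_; _%_; z≤n; s≤s)
import Data.Nat.DivMod as DM
open import Data.Nat.Logarithm using (⌊log₂_⌋; ⌊log₂[2^n]⌋≡n)
import Data.Nat.Properties as NP
open import Data.Product using (∃; ∃₂; _×_; _,_; proj₁; proj₂; uncurry)
open import Data.Sum using (_⊎_; inj₁; inj₂)
open import Data.Vec using (Vec)
import Data.Vec as V
open import Function using (_∘_; id)
open import Function.Bundles using (Equivalence)
open import Relation.Nullary using (¬_; does)
open import Relation.Nullary.Decidable using (⌊_⌋; toWitness; dec-true; isYes≗does)
import Relation.Unary as U
open import Relation.Binary.PropositionalEquality using (_≡_; refl; sym; trans; cong; cong₂; subst; module ≡-Reasoning)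

open import Defs

∧-elim : ∀ {x y} → x ∧ y ≡ true → (x ≡ true) × (y ≡ true)
∧-elim {true} {true} refl = refl , refl

∧-intro : ∀ {x y} → x ≡ true → y ≡ true → x ∧ y ≡ true
∧-intro refl refl = refl

∨-elim : ∀ {x y} → x ∨ y ≡ true → (x ≡ true) ⊎ (y ≡ true)
∨-elim {true} _ = inj₁ refl
∨-elim {false} e = inj₂ e

⇒-elim : ∀ {x y} → not x ∨ y ≡ true → x ≡ true → y ≡ true
⇒-elim {true} e refl = e

⇒-intro : ∀ {x y} → (x ≡ true → y ≡ true) → not x ∨ y ≡ true
⇒-intro {true} H = H refl
⇒-intro {false} _ = refl

≡true-antisym : ∀ {x y} → (x ≡ true → y ≡ true) → (y ≡ true → x ≡ true) → x ≡ y
≡true-antisym {true} H _ = sym (H refl)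
≡true-antisym {false} {true} _ H = H refl
≡true-antisym {false} {false} _ _ = refl

∧-interchange : ∀ a b c d → (a ∧ b) ∧ (c ∧ d) ≡ (a ∧ c) ∧ (b ∧ d)
∧-interchange true b true d = refl
∧-interchange true b false d = BP.∧-zeroʳ b
∧-interchange false b c d = refl

every : (n : ℕ) → (Fin n → Bool) → Bool
every zero f = true
every (suc n) f = f F.zero ∧ every n (f ∘ F.suc)

every-intro : ∀ n {f : Fin n → Bool} → (∀ j → f j ≡ true) → every n f ≡ true
every-intro zero H = refl
every-intro (suc n) H = ∧-intro (H F.zero) (every-intro n (H ∘ F.suc))

every-elim : ∀ n {f : Fin n → Bool} → every n f ≡ true → ∀ j → f j ≡ true
every-elim (suc n) e F.zero = proj₁ (∧-elim e)
every-elim (suc n) {f} e (F.suc j) = every-elim n (proj₂ (∧-elim {f F.zero} e)) j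

every-cong : ∀ n {f g : Fin n → Bool} → (∀ j → f j ≡ g j) → every n f ≡ every n g
every-cong zero H = refl
every-cong (suc n) H = cong₂ _∧_ (H F.zero) (every-cong n (H ∘ F.suc))

all-tabulate : ∀ {A : Set} n (p : A → Bool) (f : Fin n → A) → all p (tabulate f) ≡ every n (p ∘ f)
all-tabulate zero p f = refl
all-tabulate (suc n) p f = cong (p (f F.zero) ∧_) (all-tabulate n p (f ∘ F.suc))

any-intro : ∀ {A : Set} (p : A → Bool) {x xs} → x ∈ xs → p x ≡ true → any p xs ≡ true
any-intro p (here refl) e rewrite e = refl
any-intro p {xs = y ∷ _} (there m) e rewrite any-intro p m e = BP.∨-zeroʳ (p y)

any-elim : ∀ {A : Set} (p : A → Bool) xs → any p xs ≡ true → ∃ λ x → x ∈ xs × p x ≡ true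
any-elim p (x ∷ xs) e with ∨-elim {p x} e
... | inj₁ px = x , here refl , px
... | inj₂ rest with any-elim p xs rest
...   | y , m , py = y , there m , py

all-intro : ∀ {A : Set} (p : A → Bool) xs → (∀ {x} → x ∈ xs → p x ≡ true) → all p xs ≡ true
all-intro p [] H = refl
all-intro p (x ∷ xs) H = ∧-intro (H (here refl)) (all-intro p xs (H ∘ there))

all-elim : ∀ {A : Set} (p : A → Bool) {xs x} → all p xs ≡ true → x ∈ xs → p x ≡ true
all-elim p e (here refl) = proj₁ (∧-elim e)
all-elim p {y ∷ _} e (there m) = all-elim p (proj₂ (∧-elim {p y} e)) m

any-cong : ∀ {A : Set} {p q : A → Bool} xs → (∀ x → p x ≡ q x) → any p xs ≡ any q xs
any-cong [] H = refl
any-cong (x ∷ xs) H = cong₂ _∨_ (H x) (any-cong xs H)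

any-++ : ∀ {A : Set} (p : A → Bool) xs ys → any p (xs ++ ys) ≡ any p xs ∨ any p ys
any-++ p [] ys = refl
any-++ p (x ∷ xs) ys rewrite any-++ p xs ys = sym (BP.∨-assoc (p x) (any p xs) (any p ys))

any-concatMap : ∀ {A C : Set} (p : C → Bool) (f : A → List C) xs →
  any p (concatMap f xs) ≡ any (λ x → any p (f x)) xs
any-concatMap p f [] = refl
any-concatMap p f (x ∷ xs) =
  trans (any-++ p (f x) (concatMap f xs)) (cong (any p (f x) ∨_) (any-concatMap p f xs))

any-map : ∀ {A C : Set} (p : C → Bool) (f : A → C) xs → any p (map f xs) ≡ any (p ∘ f) xs
any-map p f [] = refl
any-map p f (x ∷ xs) = cong (p (f x) ∨_) (any-map p f xs)

any-false : ∀ {A : Set} (xs : List A) → any (λ _ → false) xs ≡ false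
any-false [] = refl
any-false (_ ∷ xs) = any-false xs

any-tabulate-false : ∀ {A : Set} (p : A → Bool) {m} (g : Fin m → A) → (∀ i → p (g i) ≡ false) →
  any p (tabulate g) ≡ false
any-tabulate-false p {zero} g H = refl
any-tabulate-false p {suc m} g H rewrite H F.zero = any-tabulate-false p (g ∘ F.suc) (H ∘ F.suc)

any-∧ˡ : ∀ {A : Set} a (q : A → Bool) xs → any (λ y → a ∧ q y) xs ≡ a ∧ any q xs
any-∧ˡ false q xs = any-false xs
any-∧ˡ true q xs = refl

any-∧ʳ : ∀ {A : Set} (q : A → Bool) b xs → any (λ y → q y ∧ b) xs ≡ any q xs ∧ b
any-∧ʳ q b xs = trans (any-cong xs (λ y → BP.∧-comm (q y) b))
                 (trans (any-∧ˡ b q xs) (BP.∧-comm b (any q xs)))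

0<ᵇcountL : ∀ {A : Set} (p : A → Bool) xs → (0 <ᵇ countL p xs) ≡ any p xs
0<ᵇcountL p [] = refl
0<ᵇcountL p (x ∷ xs) with p x
... | true = refl
... | false = 0<ᵇcountL p xs

countL-cong : ∀ {A : Set} {p q : A → Bool} xs → (∀ x → p x ≡ q x) → countL p xs ≡ countL q xs
countL-cong [] H = refl
countL-cong {p = p} {q} (x ∷ xs) H with p x | q x | H x
... | true | true | _ = cong suc (countL-cong xs H)
... | false | false | _ = countL-cong xs H

countL-++ : ∀ {A : Set} (p : A → Bool) xs ys → countL p (xs ++ ys) ≡ countL p xs + countL p ys
countL-++ p xs ys = trans (cong length (LP.filter-++ _ xs ys)) (LP.length-++ (filter _ xs))

countL-map : ∀ {A C : Set} (p : C → Bool) (f : A → C) xs → countL p (map f xs) ≡ countL (p ∘ f) xs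
countL-map p f [] = refl
countL-map p f (x ∷ xs) with p (f x)
... | true = cong suc (countL-map p f xs)
... | false = countL-map p f xs

countL-false : ∀ {A : Set} (xs : List A) → countL (λ _ → false) xs ≡ 0
countL-false [] = refl
countL-false (_ ∷ xs) = countL-false xs

countL-tabulate-true : ∀ {A : Set} (p : A → Bool) {m} (g : Fin m → A) → (∀ i → p (g i) ≡ true) →
  countL p (tabulate g) ≡ m
countL-tabulate-true p {zero} g H = refl
countL-tabulate-true p {suc m} g H with p (g F.zero) | H F.zero
... | true | _ = cong suc (countL-tabulate-true p (g ∘ F.suc) (H ∘ F.suc))

countL-tabulate-false : ∀ {A : Set} (p : A → Bool) {m} (g : Fin m → A) → (∀ i → p (g i) ≡ false) →
  countL p (tabulate g) ≡ 0
countL-tabulate-false p {zero} g H = refl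
countL-tabulate-false p {suc m} g H with p (g F.zero) | H F.zero
... | false | _ = countL-tabulate-false p (g ∘ F.suc) (H ∘ F.suc)

countL-concatMap : ∀ {A C : Set} (p : C → Bool) (f : A → List C) (q : A → Bool) K xs →
  (∀ x → countL p (f x) ≡ (if q x then K else 0)) → countL p (concatMap f xs) ≡ countL q xs * K
countL-concatMap p f q K [] H = refl
countL-concatMap p f q K (x ∷ xs) H
  rewrite countL-++ p (f x) (concatMap f xs) | H x | countL-concatMap p f q K xs H with q x
... | true = refl
... | false = refl

countL-∧ˡ : ∀ {A : Set} a (q : A → Bool) xs → countL (λ y → a ∧ q y) xs ≡ (if a then countL q xs else 0)
countL-∧ˡ true q xs = refl
countL-∧ˡ false q xs = countL-false xs

product : (n : ℕ) → (Fin n → ℕ) → ℕ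
product zero f = 1
product (suc n) f = f F.zero * product n (f ∘ F.suc)

*≡ᵇ1 : ∀ a b → (a * b ≡ᵇ 1) ≡ (a ≡ᵇ 1) ∧ (b ≡ᵇ 1)
*≡ᵇ1 zero b = refl
*≡ᵇ1 (suc zero) b = cong (_≡ᵇ 1) (NP.+-identityʳ b)
*≡ᵇ1 (suc (suc a)) zero = cong (_≡ᵇ 1) (NP.*-zeroʳ a)
*≡ᵇ1 (suc (suc a)) (suc b) = cong (λ z → suc z ≡ᵇ 1) (NP.+-suc b (b + a * suc b))

product≡ᵇ1 : ∀ n f → (product n f ≡ᵇ 1) ≡ every n (λ j → f j ≡ᵇ 1)
product≡ᵇ1 zero f = refl
product≡ᵇ1 (suc n) f =
  trans (*≡ᵇ1 (f F.zero) (product n (f ∘ F.suc))) (cong ((f F.zero ≡ᵇ 1) ∧_) (product≡ᵇ1 n (f ∘ F.suc)))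

-- Binary encoding of index sets

bitValue : Bool → ℕ
bitValue true = 1
bitValue false = 0

fromBits : (n : ℕ) → (Fin n → Bool) → ℕ
fromBits zero β = 0
fromBits (suc n) β = bitValue (β F.zero) + fromBits n (β ∘ F.suc) * 2

fromBits< : ∀ n β → fromBits n β < 2 ^ n
fromBits< zero β = s≤s z≤n
fromBits< (suc n) β = begin-strict
  bitValue (β F.zero) + fromBits n (β ∘ F.suc) * 2  <⟨ s≤s (NP.+-monoˡ-≤ _ (bitValue≤1 (β F.zero))) ⟩
  suc (1 + fromBits n (β ∘ F.suc) * 2)              ≤⟨ NP.*-monoˡ-≤ 2 (fromBits< n (β ∘ F.suc)) ⟩
  2 ^ n * 2                                         ≡⟨ NP.*-comm (2 ^ n) 2 ⟩
  2 ^ suc n                                         ∎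
  where
  open NP.≤-Reasoning
  bitValue≤1 : ∀ c → bitValue c ≤ 1
  bitValue≤1 true = s≤s z≤n
  bitValue≤1 false = z≤n

lowestBit : ∀ c e → ((bitValue c + e * 2) % 2 ≡ᵇ 1) ≡ c
lowestBit true e = cong (_≡ᵇ 1) (DM.[m+kn]%n≡m%n 1 e 2)
lowestBit false e = cong (_≡ᵇ 1) (DM.m*n%n≡0 e 2)

dropLowestBit : ∀ c e → (bitValue c + e * 2) / 2 ≡ e
dropLowestBit false e = DM.m*n/n≡m e 2
dropLowestBit true e =
  trans (DM.+-distrib-/ 1 (e * 2) (subst (λ r → 1 + r < 2) (sym (DM.m*n%n≡0 e 2)) NP.≤-refl))
        (DM.m*n/n≡m e 2)

bit-fromBits : ∀ n β (a : Fin n) → (bit (fromBits n β) (toℕ a) ≡ᵇ 1) ≡ β a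
bit-fromBits (suc n) β F.zero = lowestBit (β F.zero) (fromBits n (β ∘ F.suc))
bit-fromBits (suc n) β (F.suc a)
  rewrite dropLowestBit (β F.zero) (fromBits n (β ∘ F.suc)) = bit-fromBits n (β ∘ F.suc) a

fromBits-bit : ∀ n x → x < 2 ^ n → fromBits n (λ a → bit x (toℕ a) ≡ᵇ 1) ≡ x
fromBits-bit zero zero _ = refl
fromBits-bit zero (suc x) (s≤s ())
fromBits-bit (suc n) x x<2^1+n =
  trans (cong₂ _+_ (bitValue-digit (x % 2) (DM.m%n<n x 2)) (cong (_* 2) (fromBits-bit n (x / 2) x/2<2^n)))
        (sym (DM.m≡m%n+[m/n]*n x 2))
  where
  bitValue-digit : ∀ r → r < 2 → bitValue (r ≡ᵇ 1) ≡ r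
  bitValue-digit zero _ = refl
  bitValue-digit (suc zero) _ = refl
  bitValue-digit (suc (suc r)) (s≤s (s≤s ()))
  x/2<2^n : x / 2 < 2 ^ n
  x/2<2^n = DM.m<n*o⇒m/o<n (subst (x <_) (NP.*-comm 2 (2 ^ n)) x<2^1+n)

index : ∀ {n} → (Fin n → Bool) → Idx n
index {n} β = fromℕ< (fromBits< n β)

inP-index : ∀ {n} (β : Fin n → Bool) a → inP (index β) a ≡ β a
inP-index {n} β a rewrite FP.toℕ-fromℕ< (fromBits< n β) = bit-fromBits n β a

index-inP : ∀ {n} (g : Idx n) → index (inP {n} g) ≡ g
index-inP {n} g = FP.toℕ-injective
  (trans (FP.toℕ-fromℕ< (fromBits< n (inP {n} g))) (fromBits-bit n (toℕ g) (FP.toℕ<n g)))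

index-cong : ∀ {n} {β γ : Fin n → Bool} → (∀ a → β a ≡ γ a) → index β ≡ index γ
index-cong {n} {β} {γ} H = FP.fromℕ<-cong _ _ (fromBits-cong n H) (fromBits< n β) (fromBits< n γ)
  where
  fromBits-cong : ∀ n {β γ : Fin n → Bool} → (∀ a → β a ≡ γ a) → fromBits n β ≡ fromBits n γ
  fromBits-cong zero H = refl
  fromBits-cong (suc n) H =
    cong₂ (λ x y → bitValue x + y * 2) (H F.zero) (fromBits-cong n (H ∘ F.suc))

-- Coordinatewise description of the relations

differsIff : ∀ {m} → Fin m → Fin m → Bool → Bool
differsIff s t b = not (not ⌊ s F.≟ t ⌋ xor b)

related : ∀ {n} {u : Fin n → ℕ} → (Fin n → Bool) → Point n u → Point n u → Bool
related {n} β x y = every n (λ a → differsIff (x a) (y a) (β a))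

inR≡related : ∀ {n} {u : Fin n → ℕ} (g : Idx n) (x y : Point n u) →
  inR {n} {u} g x y ≡ related (inP {n} g) x y
inR≡related {n} g x y = all-tabulate n _ id

pathVia : ∀ {m} → Fin m → Fin m → Bool → Bool → Fin m → Bool
pathVia x y β γ t = differsIff x t β ∧ differsIff t y γ

any-points-related : ∀ n (u : Fin n → ℕ) (β γ : Fin n → Bool) (x y : Point n u) →
  any (λ w → related β x w ∧ related γ w y) (points n u) ≡
  every n (λ j → any (pathVia (x j) (y j) (β j) (γ j)) (allFin (u j)))
any-points-related zero u β γ x y = refl
any-points-related (suc n) u β γ x y = begin
  any P (concatMap (λ t → map (cons t) W) T)       ≡⟨ any-concatMap P (λ t → map (cons t) W) T ⟩
  any (λ t → any P (map (cons t) W)) T             ≡⟨ any-cong T split ⟩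
  any (λ t → path t ∧ any Q W) T                   ≡⟨ any-∧ʳ path (any Q W) T ⟩
  any path T ∧ any Q W
    ≡⟨ cong (any path T ∧_) (any-points-related n _ (β ∘ F.suc) (γ ∘ F.suc) (x ∘ F.suc) (y ∘ F.suc)) ⟩
  every (suc n) (λ j → any (pathVia (x j) (y j) (β j) (γ j)) (allFin (u j))) ∎
  where
  open ≡-Reasoning
  P : Point (suc n) u → Bool
  P w = related β x w ∧ related γ w y
  W : List (Point n (u ∘ F.suc))
  W = points n (u ∘ F.suc)
  T : List (Fin (u F.zero))
  T = allFin (u F.zero)
  path : Fin (u F.zero) → Bool
  path = pathVia (x F.zero) (y F.zero) (β F.zero) (γ F.zero)
  Q : Point n (u ∘ F.suc) → Bool
  Q w = related (β ∘ F.suc) (x ∘ F.suc) w ∧ related (γ ∘ F.suc) w (y ∘ F.suc)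
  split : ∀ t → any P (map (cons t) W) ≡ path t ∧ any Q W
  split t = trans (any-map P (cons t) W)
    (trans (any-cong W (λ w → ∧-interchange (differsIff (x F.zero) t (β F.zero))
                                            (related (β ∘ F.suc) (x ∘ F.suc) w)
                                            (differsIff t (y F.zero) (γ F.zero))
                                            (related (γ ∘ F.suc) w (y ∘ F.suc))))
           (any-∧ˡ (path t) Q W))

countL-points-related : ∀ n (u : Fin n → ℕ) (β : Fin n → Bool) (x : Point n u) →
  countL (related β x) (points n u) ≡ product n (λ j → countL (λ t → differsIff (x j) t (β j)) (allFin (u j)))
countL-points-related zero u β x = refl
countL-points-related (suc n) u β x =
  countL-concatMap (related β x) (λ t → map (cons t) W) first _ (allFin (u F.zero)) λ t →
    trans (countL-map (related β x) (cons t) W)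
          (trans (countL-∧ˡ (first t) _ W)
                 (cong (λ c → if first t then c else 0) (countL-points-related n _ (β ∘ F.suc) (x ∘ F.suc))))
  where
  W : List (Point n (u ∘ F.suc))
  W = points n (u ∘ F.suc)
  first : Fin (u F.zero) → Bool
  first t = differsIff (x F.zero) t (β F.zero)

-- In a coordinate of size u, `composable (2 <ᵇ u) b c a` says that the relations
-- "differ iff b" and "differ iff c" compose to contain "differ iff a".
composable : Bool → Bool → Bool → Bool → Bool
composable big b c a = not (a xor (b xor c)) ∨ (big ∧ (b ∧ c))

any-first-three : ∀ {X : Set} (p : X → Bool) a b c {m} (g : Fin m → X) → (∀ i → p (g i) ≡ p c) →
  any p (a ∷ b ∷ c ∷ tabulate g) ≡ p a ∨ (p b ∨ p c)
any-first-three p a b c g H = cong (λ r → p a ∨ (p b ∨ r)) (absorb (p c) refl)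
  where
  absorb : ∀ z → p c ≡ z → p c ∨ any p (tabulate g) ≡ p c
  absorb true e = trans (cong (_∨ any p (tabulate g)) e) (sym e)
  absorb false e = trans (cong₂ _∨_ e (any-tabulate-false p g (λ i → trans (H i) e))) (sym e)

coordinate-composable : ∀ m β γ α (0<m : 0 < m) (1<m : 1 < m) →
  any (pathVia (fromℕ< 0<m) (if α then fromℕ< 1<m else fromℕ< 0<m) β γ) (allFin m) ≡ composable (2 <ᵇ m) β γ α
coordinate-composable (suc zero) _ _ _ _ (s≤s ())
coordinate-composable (suc (suc zero)) true true true _ _ = refl
coordinate-composable (suc (suc zero)) true true false _ _ = refl
coordinate-composable (suc (suc zero)) true false true _ _ = refl
coordinate-composable (suc (suc zero)) true false false _ _ = refl
coordinate-composable (suc (suc zero)) false true true _ _ = refl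
coordinate-composable (suc (suc zero)) false true false _ _ = refl
coordinate-composable (suc (suc zero)) false false true _ _ = refl
coordinate-composable (suc (suc zero)) false false false _ _ = refl
coordinate-composable (suc (suc (suc m))) β γ α _ _ =
  trans (any-first-three (via α) t₀ t₁ t₂ (F.suc ∘ F.suc ∘ F.suc) (beyond α)) (threeCases β γ α)
  where
  t₀ t₁ t₂ : Fin (3 + m)
  t₀ = F.zero
  t₁ = F.suc F.zero
  t₂ = F.suc (F.suc F.zero)
  via : Bool → Fin (3 + m) → Bool
  via α = pathVia t₀ (if α then t₁ else t₀) β γ
  beyond : ∀ α i → via α (F.suc (F.suc (F.suc i))) ≡ via α t₂
  beyond true i = refl
  beyond false i = refl
  threeCases : ∀ β γ α → let p = pathVia t₀ (if α then t₁ else t₀) β γ in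
    p t₀ ∨ (p t₁ ∨ p t₂) ≡ composable true β γ α
  threeCases true true true = refl
  threeCases true true false = refl
  threeCases true false true = refl
  threeCases true false false = refl
  threeCases false true true = refl
  threeCases false true false = refl
  threeCases false false true = refl
  threeCases false false false = refl

coordinate-valency : ∀ m β (0<m : 0 < m) → 1 < m →
  (countL (λ t → differsIff (fromℕ< 0<m) t β) (allFin m) ≡ᵇ 1) ≡ not β ∨ not (2 <ᵇ m)
coordinate-valency (suc zero) β _ (s≤s ())
coordinate-valency (suc (suc m)) false _ _ =
  cong (λ c → suc c ≡ᵇ 1) (countL-tabulate-false (λ t → differsIff {2 + m} F.zero t false) F.suc (λ _ → refl))
coordinate-valency (suc (suc m)) true _ _ =
  trans (cong (_≡ᵇ 1) (countL-tabulate-true (λ t → differsIff {2 + m} F.zero t true) F.suc (λ _ → refl)))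
        (onlyIfTwo m)
  where
  onlyIfTwo : ∀ m → (suc m ≡ᵇ 1) ≡ not (2 <ᵇ suc (suc m))
  onlyIfTwo zero = refl
  onlyIfTwo (suc _) = refl

-- Selecting coordinates

sucIf : Bool → ℕ → ℕ
sucIf true m = suc m
sucIf false m = m

countᶠ : ∀ {n} → (Fin n → Bool) → ℕ
countᶠ {zero} q = 0
countᶠ {suc n} q = sucIf (q F.zero) (countᶠ (q ∘ F.suc))

consIf : ∀ {m} c → Bool → Vec Bool m → Vec Bool (sucIf c m)
consIf true x v = x V.∷ v
consIf false x v = v

headIf : ∀ {m} c → Vec Bool (sucIf c m) → Bool
headIf true (x V.∷ v) = x
headIf false v = false

tailIf : ∀ {m} c → Vec Bool (sucIf c m) → Vec Bool m
tailIf true (x V.∷ v) = v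
tailIf false v = v

select : ∀ {n} (q : Fin n → Bool) → (Fin n → Bool) → Vec Bool (countᶠ q)
select {zero} q β = V.[]
select {suc n} q β = consIf (q F.zero) (β F.zero) (select (q ∘ F.suc) (β ∘ F.suc))

extend : ∀ {n} (q : Fin n → Bool) → Vec Bool (countᶠ q) → Fin n → Bool
extend {suc n} q v F.zero = headIf (q F.zero) v
extend {suc n} q v (F.suc a) = extend (q ∘ F.suc) (tailIf (q F.zero) v) a

select-extend : ∀ {n} (q : Fin n → Bool) v → select q (extend q v) ≡ v
select-extend {zero} q V.[] = refl
select-extend {suc n} q v =
  trans (cong (consIf (q F.zero) (headIf (q F.zero) v)) (select-extend (q ∘ F.suc) (tailIf (q F.zero) v)))
        (consIf-headIf-tailIf (q F.zero) v)
  where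
  consIf-headIf-tailIf : ∀ {m} c (v : Vec Bool (sucIf c m)) → consIf c (headIf c v) (tailIf c v) ≡ v
  consIf-headIf-tailIf true (x V.∷ v) = refl
  consIf-headIf-tailIf false v = refl

extend-select : ∀ {n} (q β : Fin n → Bool) a → extend q (select q β) a ≡ q a ∧ β a
extend-select {suc n} q β F.zero with q F.zero
... | true = refl
... | false = refl
extend-select {suc n} q β (F.suc a) with q F.zero
... | true = extend-select (q ∘ F.suc) (β ∘ F.suc) a
... | false = extend-select (q ∘ F.suc) (β ∘ F.suc) a

select-cong : ∀ {n} (q : Fin n → Bool) {β γ} → (∀ a → q a ≡ true → β a ≡ γ a) → select q β ≡ select q γ
select-cong {zero} q H = refl
select-cong {suc n} q {β} {γ} H with q F.zero | H F.zero
... | true | H₀ = cong₂ V._∷_ (H₀ refl) (select-cong (q ∘ F.suc) (H ∘ F.suc))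
... | false | _ = select-cong (q ∘ F.suc) (H ∘ F.suc)

select-xor : ∀ {n} (q β γ : Fin n → Bool) →
  select q (λ a → β a xor γ a) ≡ V.zipWith _xor_ (select q β) (select q γ)
select-xor {zero} q β γ = refl
select-xor {suc n} q β γ with q F.zero
... | true = cong ((β F.zero xor γ F.zero) V.∷_) (select-xor (q ∘ F.suc) (β ∘ F.suc) (γ ∘ F.suc))
... | false = select-xor (q ∘ F.suc) (β ∘ F.suc) (γ ∘ F.suc)

select-false : ∀ {n} (q : Fin n → Bool) → select q (λ _ → false) ≡ V.replicate (countᶠ q) false
select-false {zero} q = refl
select-false {suc n} q with q F.zero
... | true = cong (false V.∷_) (select-false (q ∘ F.suc))
... | false = select-false (q ∘ F.suc)

extend-⊆ : ∀ {n} (q : Fin n → Bool) v a → extend q v a ≡ true → q a ≡ true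
extend-⊆ q v a e = proj₁ (∧-elim (begin
  q a ∧ extend q v a                  ≡⟨ extend-select q (extend q v) a ⟨
  extend q (select q (extend q v)) a  ≡⟨ cong (λ w → extend q w a) (select-extend q v) ⟩
  extend q v a                        ≡⟨ e ⟩
  true                                ∎))
  where open ≡-Reasoning

extend-outside : ∀ {n} (q : Fin n → Bool) v a → q a ≡ false → extend q v a ≡ false
extend-outside q v a qa≡false with extend q v a in e
... | false = refl
... | true with trans (sym qa≡false) (extend-⊆ q v a e)
...   | ()

select-injective : ∀ {n} (q : Fin n → Bool) {β γ} → select q β ≡ select q γ → ∀ a → q a ≡ true → β a ≡ γ a
select-injective q {β} {γ} e a qa with q a | extend-select q β a | extend-select q γ a
... | true | eβ | eγ = trans (sym eβ) (trans (cong (λ v → extend q v a) e) eγ)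

countL-allFin : ∀ {n} (q : Fin n → Bool) → countL q (allFin n) ≡ countᶠ q
countL-allFin q = countL-tabulate q id
  where
  countL-tabulate : ∀ {X : Set} {n} (q : X → Bool) (f : Fin n → X) → countL q (tabulate f) ≡ countᶠ (q ∘ f)
  countL-tabulate {n = zero} q f = refl
  countL-tabulate {n = suc n} q f with q (f F.zero)
  ... | true = cong suc (countL-tabulate q (f ∘ F.suc))
  ... | false = countL-tabulate q (f ∘ F.suc)

-- Subspaces of 𝔽₂ᵐ

eqVec⇒≡ : ∀ {m} (x y : Vec Bool m) → eqVec x y ≡ true → x ≡ y
eqVec⇒≡ V.[] V.[] e = refl
eqVec⇒≡ (true V.∷ x) (true V.∷ y) e = cong (true V.∷_) (eqVec⇒≡ x y e)
eqVec⇒≡ (false V.∷ x) (false V.∷ y) e = cong (false V.∷_) (eqVec⇒≡ x y e)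

eqVec-refl : ∀ {m} (x : Vec Bool m) → eqVec x x ≡ true
eqVec-refl V.[] = refl
eqVec-refl (true V.∷ x) = eqVec-refl x
eqVec-refl (false V.∷ x) = eqVec-refl x

memVec⇒∈ : ∀ {m} {x : Vec Bool m} S → memVec x S ≡ true → x ∈ S
memVec⇒∈ {x = x} S e with any-elim (eqVec x) S e
... | y , y∈S , x≈y = subst (_∈ S) (sym (eqVec⇒≡ x y x≈y)) y∈S

∈⇒memVec : ∀ {m} {x : Vec Bool m} {S} → x ∈ S → memVec x S ≡ true
∈⇒memVec {x = x} x∈S = any-intro (eqVec x) x∈S (eqVec-refl x)

∈-allVecs : ∀ {m} (v : Vec Bool m) → v ∈ allVecs m
∈-allVecs V.[] = here refl
∈-allVecs (true V.∷ v) = MP.∈-++⁺ˡ (MP.∈-map⁺ (true V.∷_) (∈-allVecs v))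
∈-allVecs {suc m} (false V.∷ v) =
  MP.∈-++⁺ʳ (map (true V.∷_) (allVecs m)) (MP.∈-++⁺ˡ (MP.∈-map⁺ (false V.∷_) (∈-allVecs v)))

length-allVecs : ∀ m → length (allVecs m) ≡ 2 ^ m
length-allVecs zero = refl
length-allVecs (suc m) rewrite LP.length-++ (map (true V.∷_) (allVecs m)) {map (false V.∷_) (allVecs m) ++ []}
  | LP.length-++ (map (false V.∷_) (allVecs m)) {[]}
  | LP.length-map (true V.∷_) (allVecs m) | LP.length-map (false V.∷_) (allVecs m) | length-allVecs m = refl

allVecs-Unique : ∀ m → Unique (allVecs m)
allVecs-Unique zero = All.[] AP.∷ AP.[]
allVecs-Unique (suc m) =
  UP.++⁺ (UP.map⁺ ∷-injectiveʳ (allVecs-Unique m))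
         (UP.++⁺ (UP.map⁺ ∷-injectiveʳ (allVecs-Unique m)) AP.[] (λ { (_ , ()) }))
         disjoint
  where
  ∷-injectiveʳ : ∀ {b : Bool} {x y : Vec Bool m} → b V.∷ x ≡ b V.∷ y → x ≡ y
  ∷-injectiveʳ refl = refl
  disjoint : ∀ {v} → ¬ (v ∈ map (true V.∷_) (allVecs m) × v ∈ (map (false V.∷_) (allVecs m) ++ []))
  disjoint (v∈₁ , v∈₂) with MP.∈-map⁻ (true V.∷_) v∈₁ | MP.∈-++⁻ (map (false V.∷_) (allVecs m)) v∈₂
  ... | _ , _ , refl | inj₁ v∈₃ with MP.∈-map⁻ (false V.∷_) v∈₃
  ...   | _ , _ , ()
  disjoint (v∈₁ , v∈₂) | _ , _ , refl | inj₂ ()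

module _ {m : ℕ} {V : List (Vec Bool m)} where

  isSubspace⇒0∈ : isSubspace V ≡ true → V.replicate m false ∈ V
  isSubspace⇒0∈ e = memVec⇒∈ V (proj₁ (∧-elim e))

  isSubspace⇒xor∈ : isSubspace V ≡ true → ∀ {x y} → x ∈ V → y ∈ V → V.zipWith _xor_ x y ∈ V
  isSubspace⇒xor∈ e {x} {y} x∈V y∈V =
    memVec⇒∈ V (all-elim _ (all-elim _ (proj₂ (∧-elim {memVec (V.replicate m false) V} e)) x∈V) y∈V)

  isSubspace-intro : V.replicate m false ∈ V → (∀ {x y} → x ∈ V → y ∈ V → V.zipWith _xor_ x y ∈ V) →
    isSubspace V ≡ true
  isSubspace-intro 0∈V xor∈V =
    ∧-intro (∈⇒memVec 0∈V) (all-intro _ V (λ x∈V → all-intro _ V (λ y∈V → ∈⇒memVec (xor∈V x∈V y∈V))))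

-- Sublists and duplicate-free lists

module _ {A : Set} where

  filter∈sublists : ∀ {P : A → Set} (P? : U.Decidable P) xs → filter P? xs ∈ sublists xs
  filter∈sublists P? [] = here refl
  filter∈sublists P? (x ∷ xs) with does (P? x)
  ... | true = MP.∈-++⁺ˡ (MP.∈-map⁺ (x ∷_) (filter∈sublists P? xs))
  ... | false = MP.∈-++⁺ʳ (map (x ∷_) (sublists xs)) (filter∈sublists P? xs)

  ∈-sublists-∷⁻ : ∀ {x : A} {xs B} → B ∈ sublists (x ∷ xs) →
    (∃ λ B′ → B′ ∈ sublists xs × B ≡ x ∷ B′) ⊎ B ∈ sublists xs
  ∈-sublists-∷⁻ {x} {xs} B∈ with MP.∈-++⁻ (map (x ∷_) (sublists xs)) B∈
  ... | inj₁ B∈₁ = inj₁ (MP.∈-map⁻ (x ∷_) B∈₁)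
  ... | inj₂ B∈₂ = inj₂ B∈₂

  sublist⇒⊆ : ∀ {xs B : List A} → B ∈ sublists xs → B ⊆ xs
  sublist⇒⊆ {[]} (here refl) ()
  sublist⇒⊆ {x ∷ xs} B∈ y∈B with ∈-sublists-∷⁻ {x} {xs} B∈
  ... | inj₂ B∈′ = there (sublist⇒⊆ B∈′ y∈B)
  ... | inj₁ (B′ , B′∈ , refl) with y∈B
  ...   | here e = here e
  ...   | there y∈B′ = there (sublist⇒⊆ B′∈ y∈B′)

  sublists-Unique : ∀ {xs : List A} → Unique xs → Unique (sublists xs)
  sublists-Unique {[]} _ = All.[] AP.∷ AP.[]
  sublists-Unique {x ∷ xs} (x∉xs AP.∷ uxs) =
    UP.++⁺ (UP.map⁺ LP.∷-injectiveʳ (sublists-Unique uxs)) (sublists-Unique uxs) disjoint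
    where
    disjoint : ∀ {B} → ¬ (B ∈ map (x ∷_) (sublists xs) × B ∈ sublists xs)
    disjoint (B∈₁ , B∈₂) with MP.∈-map⁻ (x ∷_) B∈₁
    ... | _ , _ , refl = All.lookup x∉xs (sublist⇒⊆ B∈₂ (here refl)) refl

  sublists-ext : ∀ {xs : List A} → Unique xs → ∀ {B C} → B ∈ sublists xs → C ∈ sublists xs →
    B ⊆ C → C ⊆ B → B ≡ C
  sublists-ext {[]} _ (here refl) (here refl) _ _ = refl
  sublists-ext {x ∷ xs} (x∉xs AP.∷ uxs) B∈ C∈ B⊆C C⊆B
    with ∈-sublists-∷⁻ {x} {xs} B∈ | ∈-sublists-∷⁻ {x} {xs} C∈
  ... | inj₁ (B′ , B′∈ , refl) | inj₁ (C′ , C′∈ , refl) =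
    cong (x ∷_) (sublists-ext uxs B′∈ C′∈ (λ y∈ → dropHead B′∈ (B⊆C (there y∈)) y∈)
                                          (λ y∈ → dropHead C′∈ (C⊆B (there y∈)) y∈))
    where
    dropHead : ∀ {D E y} → D ∈ sublists xs → y ∈ x ∷ E → y ∈ D → y ∈ E
    dropHead D∈ (here refl) y∈D = ⊥-elim (All.lookup x∉xs (sublist⇒⊆ D∈ y∈D) refl)
    dropHead D∈ (there y∈E) y∈D = y∈E
  ... | inj₁ (_ , _ , refl) | inj₂ C∈′ = ⊥-elim (All.lookup x∉xs (sublist⇒⊆ C∈′ (B⊆C (here refl))) refl)
  ... | inj₂ B∈′ | inj₁ (_ , _ , refl) = ⊥-elim (All.lookup x∉xs (sublist⇒⊆ B∈′ (C⊆B (here refl))) refl)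
  ... | inj₂ B∈′ | inj₂ C∈′ = sublists-ext uxs B∈′ C∈′ B⊆C C⊆B

length-≤-⊆ : ∀ {A : Set} {xs ys : List A} → Unique xs → xs ⊆ ys → length xs ≤ length ys
length-≤-⊆ {xs = []} _ _ = z≤n
length-≤-⊆ {xs = x ∷ xs} {ys} (x∉xs AP.∷ uxs) xs⊆ys with MP.∈-∃++ (xs⊆ys (here refl))
... | ys₁ , ys₂ , refl = begin
  suc (length xs)                ≤⟨ s≤s (length-≤-⊆ uxs xs⊆ys₁++ys₂) ⟩
  suc (length (ys₁ ++ ys₂))      ≡⟨ cong suc (LP.length-++ ys₁) ⟩
  suc (length ys₁ + length ys₂)  ≡⟨ NP.+-suc (length ys₁) (length ys₂) ⟨
  length ys₁ + suc (length ys₂)  ≡⟨ LP.length-++ ys₁ ⟨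
  length (ys₁ ++ x ∷ ys₂)        ∎
  where
  open NP.≤-Reasoning
  xs⊆ys₁++ys₂ : xs ⊆ ys₁ ++ ys₂
  xs⊆ys₁++ys₂ z∈ with MP.∈-++⁻ ys₁ (xs⊆ys (there z∈))
  ... | inj₁ z∈₁ = MP.∈-++⁺ˡ z∈₁
  ... | inj₂ (here refl) = ⊥-elim (All.lookup x∉xs z∈ refl)
  ... | inj₂ (there z∈₂) = MP.∈-++⁺ʳ ys₁ z∈₂

length-≡-⊆⊇ : ∀ {A : Set} {xs ys : List A} → Unique xs → Unique ys → xs ⊆ ys → ys ⊆ xs →
  length xs ≡ length ys
length-≡-⊆⊇ uxs uys xs⊆ys ys⊆xs = NP.≤-antisym (length-≤-⊆ uxs xs⊆ys) (length-≤-⊆ uys ys⊆xs)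

map-Unique : ∀ {A C : Set} (f : A → C) {xs} → Unique xs →
  (∀ {x y} → x ∈ xs → y ∈ xs → f x ≡ f y → x ≡ y) → Unique (map f xs)
map-Unique f {[]} _ _ = AP.[]
map-Unique f {x ∷ xs} (x∉xs AP.∷ uxs) f-inj =
  AllP.map⁺ (All.tabulate (λ y∈ fx≡fy → All.lookup x∉xs y∈ (f-inj (here refl) (there y∈) fx≡fy)))
  AP.∷ map-Unique f uxs (λ x∈ y∈ → f-inj (there x∈) (there y∈))

length-cartesianProduct : ∀ {X Y : Set} (xs : List X) (ys : List Y) →
  length (cartesianProduct xs ys) ≡ length xs * length ys
length-cartesianProduct [] ys = refl
length-cartesianProduct (x ∷ xs) ys =
  trans (LP.length-++ (map (x ,_) ys)) (cong₂ _+_ (LP.length-map (x ,_) ys) (length-cartesianProduct xs ys))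

composable-xor : ∀ t b c → composable t b c (b xor c) ≡ true
composable-xor t b c rewrite BP.xor-same (b xor c) = refl

composable-big⁻ : ∀ {b c a} → composable true b c a ≡ true → a ≡ true → (b ≡ true) ⊎ (c ≡ true)
composable-big⁻ {true} _ _ = inj₁ refl
composable-big⁻ {false} {true} _ _ = inj₂ refl
composable-big⁻ {false} {false} {true} () _

composable-binary⁻ : ∀ {b c a} → composable false b c a ≡ true → a ≡ b xor c
composable-binary⁻ {true} {true} {false} _ = refl
composable-binary⁻ {true} {false} {true} _ = refl
composable-binary⁻ {false} {true} {true} _ = refl
composable-binary⁻ {false} {false} {false} _ = refl

composable-square : ∀ t b → composable t b b (t ∧ b) ≡ true
composable-square true true = refl
composable-square true false = refl
composable-square false true = refl
composable-square false false = refl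

composable-big-∨ : ∀ t x y → composable t (t ∧ x) (t ∧ y) (t ∧ (x ∨ y)) ≡ true
composable-big-∨ true true true = refl
composable-big-∨ true true false = refl
composable-big-∨ true false true = refl
composable-big-∨ true false false = refl
composable-big-∨ false x y = refl

composable-diagonal : ∀ t → composable t t t t ≡ true
composable-diagonal true = refl
composable-diagonal false = refl

composable-identityʳ : ∀ t b → composable t b false b ≡ true
composable-identityʳ t true = refl
composable-identityʳ t false = refl

composable-cover : ∀ t w b a → (t ∧ a ≡ true → w ≡ true) → (not t ≡ true → a ≡ b) →
  composable t (t ∧ w) ((not t ∧ b) ∨ (t ∧ w)) a ≡ true
composable-cover true true b true _ _ = refl
composable-cover true true b false _ _ = refl
composable-cover true false b false _ _ = refl
composable-cover true false b true a⇒w _ with a⇒w refl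
... | ()
composable-cover false w true a _ a≡b rewrite a≡b refl = refl
composable-cover false w false a _ a≡b rewrite a≡b refl = refl

module FactorialScheme (n : ℕ) (u : Fin n → ℕ) (h : (a : Fin n) → 2 ≤ u a) where
  open Scheme n u h

  ℙ : Idx n → Fin n → Bool
  ℙ = inP

  big binary : Fin n → Bool
  big j = 2 <ᵇ u j
  binary j = not (big j)

  binary⇒¬big : ∀ {j} → binary j ≡ true → big j ≡ false
  binary⇒¬big {j} with big j
  ... | false = λ _ → refl

  0<u : ∀ j → 0 < u j
  0<u j = NP.≤-trans (s≤s z≤n) (h j)

  Composable : (Fin n → Bool) → (Fin n → Bool) → (Fin n → Bool) → Bool
  Composable β γ α = every n (λ j → composable (big j) (β j) (γ j) (α j))

  0<p≡Composable : ∀ b c a → (0 <ᵇ p b c a) ≡ Composable (ℙ b) (ℙ c) (ℙ a)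
  0<p≡Composable b c a = begin
    0 <ᵇ p b c a
      ≡⟨ 0<ᵇcountL _ 𝕏 ⟩
    any (λ w → inR b base w ∧ inR c w (rep a)) 𝕏
      ≡⟨ any-cong 𝕏 (λ w → cong₂ _∧_ (inR≡related b base w) (inR≡related c w (rep a))) ⟩
    any (λ w → related (ℙ b) base w ∧ related (ℙ c) w (rep a)) 𝕏
      ≡⟨ any-points-related n u (ℙ b) (ℙ c) base (rep a) ⟩
    every n (λ j → any (pathVia (base j) (rep a j) (ℙ b j) (ℙ c j)) (allFin (u j)))
      ≡⟨ every-cong n (λ j → coordinate-composable (u j) (ℙ b j) (ℙ c j) (ℙ a j) (0<u j) (h j)) ⟩
    Composable (ℙ b) (ℙ c) (ℙ a) ∎
    where open ≡-Reasoning

  k≡ᵇ1 : ∀ g → (k g ≡ᵇ 1) ≡ every n (λ j → not (ℙ g j) ∨ binary j)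
  k≡ᵇ1 g = begin
    k g ≡ᵇ 1
      ≡⟨ cong (_≡ᵇ 1) (countL-cong 𝕏 (inR≡related g base)) ⟩
    countL (related (ℙ g) base) 𝕏 ≡ᵇ 1
      ≡⟨ cong (_≡ᵇ 1) (countL-points-related n u (ℙ g) base) ⟩
    product n (λ j → countL (λ t → differsIff (base j) t (ℙ g j)) (allFin (u j))) ≡ᵇ 1
      ≡⟨ product≡ᵇ1 n _ ⟩
    every n (λ j → countL (λ t → differsIff (base j) t (ℙ g j)) (allFin (u j)) ≡ᵇ 1)
      ≡⟨ every-cong n (λ j → coordinate-valency (u j) (ℙ g j) (0<u j) (h j)) ⟩
    every n (λ j → not (ℙ g j) ∨ binary j) ∎
    where open ≡-Reasoning

  memS⇒∈ : ∀ {x} A → memS x A ≡ true → x ∈ A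
  memS⇒∈ {x} A e with any-elim (λ y → ⌊ x F.≟ y ⌋) A e
  ... | y , y∈A , x≟y = subst (_∈ A) (sym (toWitness (Equivalence.from BP.T-≡ x≟y))) y∈A

  ∈⇒memS : ∀ {x A} → x ∈ A → memS x A ≡ true
  ∈⇒memS {x} x∈A =
    any-intro (λ y → ⌊ x F.≟ y ⌋) x∈A (trans (isYes≗does (x F.≟ x)) (dec-true (x F.≟ x) refl))

  sub⇒⊆ : ∀ {X Y} → sub X Y ≡ true → X ⊆ Y
  sub⇒⊆ {X} {Y} e x∈X = memS⇒∈ Y (all-elim (λ z → memS z Y) e x∈X)

  ⊆⇒sub : ∀ {X Y} → X ⊆ Y → sub X Y ≡ true
  ⊆⇒sub {X} {Y} X⊆Y = all-intro (λ z → memS z Y) X (∈⇒memS ∘ X⊆Y)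

  ∈-prod⁻ : ∀ {A B a} → a ∈ prod A B →
    ∃₂ λ b c → b ∈ A × c ∈ B × Composable (ℙ b) (ℙ c) (ℙ a) ≡ true
  ∈-prod⁻ {A} {B} {a} a∈AB
    with any-elim _ A (proj₂ (MP.∈-filter⁻ (λ a → inProd A B a B.≟ true) {xs = 𝕊} a∈AB))
  ... | b , b∈A , e with any-elim _ B e
  ...   | c , c∈B , 0<p = b , c , b∈A , c∈B , trans (sym (0<p≡Composable b c a)) 0<p

  ∈-prod⁺ : ∀ {A B a b c} → b ∈ A → c ∈ B → Composable (ℙ b) (ℙ c) (ℙ a) ≡ true → a ∈ prod A B
  ∈-prod⁺ {A} {B} {a} {b} {c} b∈A c∈B comp =
    MP.∈-filter⁺ (λ a → inProd A B a B.≟ true) (MP.∈-allFin a)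
      (any-intro _ b∈A (any-intro _ c∈B (trans (0<p≡Composable b c a) comp)))

  ProductClosed : List (Idx n) → Set
  ProductClosed A = ∀ {a b c} → b ∈ A → c ∈ A → Composable (ℙ b) (ℙ c) (ℙ a) ≡ true → a ∈ A

  isClosed⇒nonempty : ∀ A → isClosed A ≡ true → ∃ (_∈ A)
  isClosed⇒nonempty (g ∷ _) _ = g , here refl

  isClosed⇒ProductClosed : ∀ {A} → isClosed A ≡ true → ProductClosed A
  isClosed⇒ProductClosed {A} e b∈A c∈A comp = sub⇒⊆ (proj₂ (∧-elim {not (null A)} e)) (∈-prod⁺ b∈A c∈A comp)

  ProductClosed⇒isClosed : ∀ {A g} → g ∈ A → ProductClosed A → isClosed A ≡ true
  ProductClosed⇒isClosed {A} g∈A closed = ∧-intro (nonnull g∈A) (⊆⇒sub λ a∈AA →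
    let _ , _ , b∈A , c∈A , comp = ∈-prod⁻ a∈AA in closed b∈A c∈A comp)
    where
    nonnull : ∀ {g : Idx n} {A} → g ∈ A → not (null A) ≡ true
    nonnull (here _) = refl
    nonnull (there _) = refl

  infix 4 _∈ℙ_
  _∈ℙ_ : (Fin n → Bool) → List (Idx n) → Set
  β ∈ℙ A = index β ∈ A

  ∈⇒∈ℙ : ∀ {g A} → g ∈ A → ℙ g ∈ℙ A
  ∈⇒∈ℙ {g} {A} = subst (_∈ A) (sym (index-inP {n} g))

  ∈ℙ⇒∈ : ∀ {g A} → ℙ g ∈ℙ A → g ∈ A
  ∈ℙ⇒∈ {g} {A} = subst (_∈ A) (index-inP {n} g)

  Composable-index : ∀ {β γ α} → (∀ j → composable (big j) (β j) (γ j) (α j) ≡ true) →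
    Composable (ℙ (index β)) (ℙ (index γ)) (ℙ (index α)) ≡ true
  Composable-index {β} {γ} {α} comp = every-intro n pointwise
    where
    pointwise : ∀ j → composable (big j) (ℙ (index β) j) (ℙ (index γ) j) (ℙ (index α) j) ≡ true
    pointwise j rewrite inP-index β j | inP-index γ j | inP-index α j = comp j

  Composable-big⁻ : ∀ β γ α → Composable β γ α ≡ true →
    ∀ j → big j ≡ true → α j ≡ true → (β j ≡ true) ⊎ (γ j ≡ true)
  Composable-big⁻ β γ α comp j isBig =
    composable-big⁻ (subst (λ t → composable t (β j) (γ j) (α j) ≡ true) isBig (every-elim n comp j))

  Composable-binary⁻ : ∀ β γ α → Composable β γ α ≡ true → ∀ j → binary j ≡ true → α j ≡ β j xor γ j
  Composable-binary⁻ β γ α comp j isBinary = composable-binary⁻ {β j} {γ j}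
    (subst (λ t → composable t (β j) (γ j) (α j) ≡ true) (binary⇒¬big isBinary) (every-elim n comp j))

  compose : ∀ {A} → ProductClosed A → ∀ {β γ} α → β ∈ℙ A → γ ∈ℙ A →
    (∀ j → composable (big j) (β j) (γ j) (α j) ≡ true) → α ∈ℙ A
  compose closed α β∈A γ∈A comp = closed β∈A γ∈A (Composable-index comp)

  compose-xor : ∀ {A} → ProductClosed A → ∀ {β γ} α → β ∈ℙ A → γ ∈ℙ A →
    (∀ j → α j ≡ β j xor γ j) → α ∈ℙ A
  compose-xor closed {β} {γ} α β∈A γ∈A α≡β⊕γ = compose closed α β∈A γ∈A λ j →
    subst (λ a → composable (big j) (β j) (γ j) a ≡ true) (sym (α≡β⊕γ j)) (composable-xor (big j) (β j) (γ j))

  ∅ : Fin n → Bool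
  ∅ _ = false

  bigPart binaryPart : (Fin n → Bool) → Fin n → Bool
  bigPart β j = big j ∧ β j
  binaryPart β j = binary j ∧ β j

  support : List (Idx n) → Fin n → Bool
  support B j = any (λ g → ℙ g j) B

  module ClosedSubset (A : List (Idx n)) (closed : ProductClosed A) where

    bigPart∈ : ∀ {g} → g ∈ A → bigPart (ℙ g) ∈ℙ A
    bigPart∈ {g} g∈A = compose closed _ (∈⇒∈ℙ g∈A) (∈⇒∈ℙ g∈A) (λ j → composable-square (big j) (ℙ g j))

    binaryPart∈ : ∀ {g} → g ∈ A → binaryPart (ℙ g) ∈ℙ A
    binaryPart∈ {g} g∈A = compose-xor closed _ (∈⇒∈ℙ g∈A) (bigPart∈ g∈A) (λ j → split (big j) (ℙ g j))
      where
      split : ∀ t b → not t ∧ b ≡ b xor (t ∧ b)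
      split true b = sym (BP.xor-same b)
      split false b = sym (BP.xor-identityʳ b)

    0∈ : ∀ {g} → g ∈ A → ∅ ∈ℙ A
    0∈ {g} g∈A = compose-xor closed _ (∈⇒∈ℙ g∈A) (∈⇒∈ℙ g∈A) (λ j → sym (BP.xor-same (ℙ g j)))

    binaryPart-xor∈ : ∀ {g₁ g₂} → g₁ ∈ A → g₂ ∈ A → binaryPart (λ j → ℙ g₁ j xor ℙ g₂ j) ∈ℙ A
    binaryPart-xor∈ {g₁} {g₂} g₁∈A g₂∈A = compose-xor closed _ (binaryPart∈ g₁∈A) (binaryPart∈ g₂∈A)
      (λ j → BP.∧-distribˡ-xor (binary j) (ℙ g₁ j) (ℙ g₂ j))

    bigPart-∨∈ : ∀ {β γ} → bigPart β ∈ℙ A → bigPart γ ∈ℙ A → bigPart (λ j → β j ∨ γ j) ∈ℙ A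
    bigPart-∨∈ {β} {γ} β∈A γ∈A = compose closed _ β∈A γ∈A (λ j → composable-big-∨ (big j) (β j) (γ j))

    bigPart-support∈ : ∀ {g₀} → g₀ ∈ A → ∀ B → B ⊆ A → bigPart (support B) ∈ℙ A
    bigPart-support∈ g₀∈A [] _ = subst (_∈ A) (index-cong (λ j → sym (BP.∧-zeroʳ (big j)))) (0∈ g₀∈A)
    bigPart-support∈ g₀∈A (g ∷ B) g∷B⊆A =
      bigPart-∨∈ (bigPart∈ (g∷B⊆A (here refl))) (bigPart-support∈ g₀∈A B (g∷B⊆A ∘ there))

    ∈ℙ-fromParts : ∀ {g₀ g β} → g₀ ∈ A → g ∈ A → (∀ j → big j ∧ β j ≡ true → support A j ≡ true) →
      (∀ j → binary j ≡ true → β j ≡ ℙ g j) → β ∈ℙ A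
    -- β ∈ R_W R_{W ∪ (ℙ g ∩ binary)}, where W is the big part of the support of A.
    ∈ℙ-fromParts {g₀} {g} {β} g₀∈A g∈A β⊆support β≈g = compose closed β W∈A WG∈A
        (λ j → composable-cover (big j) (support A j) (ℙ g j) (β j) (β⊆support j) (β≈g j))
      where
      W∈A : bigPart (support A) ∈ℙ A
      W∈A = bigPart-support∈ g₀∈A A id
      WG∈A : (λ j → binaryPart (ℙ g) j ∨ bigPart (support A) j) ∈ℙ A
      WG∈A = compose-xor closed _ (binaryPart∈ g∈A) W∈A (λ j → disjoint-∨ (big j) (ℙ g j) (support A j))
        where
        disjoint-∨ : ∀ t b w → (not t ∧ b) ∨ (t ∧ w) ≡ (not t ∧ b) xor (t ∧ w)
        disjoint-∨ true b w = refl
        disjoint-∨ false b w = trans (BP.∨-identityʳ b) (sym (BP.xor-identityʳ b))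

  #big #binary : ℕ
  #big = countᶠ big
  #binary = countᶠ binary

  select-index : ∀ q β → select q (ℙ (index β)) ≡ select q β
  select-index q β = select-cong q (λ a _ → inP-index β a)

  InΦ : Vec Bool #big → List (Vec Bool #binary) → Idx n → Bool
  InΦ s V g = every n (λ j → not (big j ∧ ℙ g j) ∨ extend big s j) ∧ memVec (select binary (ℙ g)) V

  Φ : Vec Bool #big → List (Vec Bool #binary) → List (Idx n)
  Φ s V = filter (λ g → InΦ s V g B.≟ true) 𝕊

  ∈Φ⁺ : ∀ s V {g} → (∀ j → big j ∧ ℙ g j ≡ true → extend big s j ≡ true) → select binary (ℙ g) ∈ V →
    g ∈ Φ s V
  ∈Φ⁺ s V {g} big⊆s binary∈V = MP.∈-filter⁺ (λ g → InΦ s V g B.≟ true) (MP.∈-allFin g)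
    (∧-intro (every-intro n (λ j → ⇒-intro (big⊆s j))) (∈⇒memVec binary∈V))

  ∈Φ⁻ : ∀ s V {g} → g ∈ Φ s V → InΦ s V g ≡ true
  ∈Φ⁻ s V g∈Φ = proj₂ (MP.∈-filter⁻ (λ g → InΦ s V g B.≟ true) {xs = 𝕊} g∈Φ)

  ∈Φ⇒big⊆ : ∀ s V {g} → g ∈ Φ s V → ∀ j → big j ∧ ℙ g j ≡ true → extend big s j ≡ true
  ∈Φ⇒big⊆ s V g∈Φ j = ⇒-elim (every-elim n (proj₁ (∧-elim (∈Φ⁻ s V g∈Φ))) j)

  ∈Φ⇒binary∈ : ∀ s V {g} → g ∈ Φ s V → select binary (ℙ g) ∈ V
  ∈Φ⇒binary∈ s V {g} g∈Φ =
    memVec⇒∈ V (proj₂ (∧-elim {every n (λ j → not (big j ∧ ℙ g j) ∨ extend big s j)} (∈Φ⁻ s V g∈Φ)))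

  Φ-ProductClosed : ∀ s V → isSubspace V ≡ true → ProductClosed (Φ s V)
  Φ-ProductClosed s V V-subspace {a} {b} {c} b∈Φ c∈Φ comp = ∈Φ⁺ s V big⊆s binary∈V
    where
    big⊆s : ∀ j → big j ∧ ℙ a j ≡ true → extend big s j ≡ true
    big⊆s j e with ∧-elim {big j} e
    ... | isBig , aj with Composable-big⁻ (ℙ b) (ℙ c) (ℙ a) comp j isBig aj
    ...   | inj₁ bj = ∈Φ⇒big⊆ s V b∈Φ j (∧-intro isBig bj)
    ...   | inj₂ cj = ∈Φ⇒big⊆ s V c∈Φ j (∧-intro isBig cj)
    binary∈V : select binary (ℙ a) ∈ V
    binary∈V = subst (_∈ V)
      (sym (trans (select-cong binary (Composable-binary⁻ (ℙ b) (ℙ c) (ℙ a) comp)) (select-xor binary (ℙ b) (ℙ c))))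
      (isSubspace⇒xor∈ V-subspace (∈Φ⇒binary∈ s V b∈Φ) (∈Φ⇒binary∈ s V c∈Φ))

  index∅∈Φ : ∀ s V → isSubspace V ≡ true → index ∅ ∈ Φ s V
  index∅∈Φ s V V-subspace = ∈Φ⁺ s V big⊆s
    (subst (_∈ V) (sym (trans (select-index binary ∅) (select-false binary))) (isSubspace⇒0∈ V-subspace))
    where
    big⊆s : ∀ j → big j ∧ ℙ (index ∅) j ≡ true → extend big s j ≡ true
    big⊆s j e with trans (sym (inP-index ∅ j)) (proj₂ (∧-elim {big j} e))
    ... | ()

  Φ-isClosed : ∀ s V → isSubspace V ≡ true → isClosed (Φ s V) ≡ true
  Φ-isClosed s V V-subspace = ProductClosed⇒isClosed (index∅∈Φ s V V-subspace) (Φ-ProductClosed s V V-subspace)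

  binaryProjections : List (Idx n) → List (Vec Bool #binary)
  binaryProjections A = filter (λ v → memVec v (map (select binary ∘ ℙ) A) B.≟ true) (allVecs #binary)

  ∈binaryProjections⁻ : ∀ {A v} → v ∈ binaryProjections A → ∃ λ g → g ∈ A × v ≡ select binary (ℙ g)
  ∈binaryProjections⁻ {A} v∈ = MP.∈-map⁻ (select binary ∘ ℙ) (memVec⇒∈ _
    (proj₂ (MP.∈-filter⁻ (λ v → memVec v (map (select binary ∘ ℙ) A) B.≟ true) {xs = allVecs #binary} v∈)))

  ∈binaryProjections⁺ : ∀ {A g} → g ∈ A → select binary (ℙ g) ∈ binaryProjections A
  ∈binaryProjections⁺ {A} g∈A = MP.∈-filter⁺ (λ v → memVec v (map (select binary ∘ ℙ) A) B.≟ true)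
    (∈-allVecs _) (∈⇒memVec (MP.∈-map⁺ (select binary ∘ ℙ) g∈A))

  binaryProjections∈sublists : ∀ A → binaryProjections A ∈ sublists (allVecs #binary)
  binaryProjections∈sublists A = filter∈sublists _ (allVecs #binary)

  module ClosedCharacterisation (A : List (Idx n)) (A-closed : isClosed A ≡ true) where
    open ClosedSubset A (isClosed⇒ProductClosed A-closed)

    g₀ : Idx n
    g₀ = proj₁ (isClosed⇒nonempty A A-closed)

    g₀∈A : g₀ ∈ A
    g₀∈A = proj₂ (isClosed⇒nonempty A A-closed)

    binaryProjections-isSubspace : isSubspace (binaryProjections A) ≡ true
    binaryProjections-isSubspace = isSubspace-intro
      (subst (_∈ binaryProjections A) (trans (select-index binary ∅) (select-false binary))
             (∈binaryProjections⁺ (0∈ g₀∈A)))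
      xor∈
      where
      xor∈ : ∀ {x y} → x ∈ binaryProjections A → y ∈ binaryProjections A →
        V.zipWith _xor_ x y ∈ binaryProjections A
      xor∈ x∈ y∈ with ∈binaryProjections⁻ x∈ | ∈binaryProjections⁻ y∈
      ... | g₁ , g₁∈A , refl | g₂ , g₂∈A , refl =
        subst (_∈ binaryProjections A) projection (∈binaryProjections⁺ (binaryPart-xor∈ g₁∈A g₂∈A))
        where
        projection : select binary (ℙ (index (binaryPart (λ j → ℙ g₁ j xor ℙ g₂ j))))
                   ≡ V.zipWith _xor_ (select binary (ℙ g₁)) (select binary (ℙ g₂))
        projection = trans (select-index binary _)
          (trans (select-cong binary (λ j isBinary → cong (_∧ (ℙ g₁ j xor ℙ g₂ j)) isBinary))
                 (select-xor binary (ℙ g₁) (ℙ g₂)))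

    Φ⊆A : ∀ {s} → (∀ j → big j ≡ true → extend big s j ≡ true → support A j ≡ true) →
      Φ s (binaryProjections A) ⊆ A
    Φ⊆A {s} s⊆support {g} g∈Φ with ∈binaryProjections⁻ (∈Φ⇒binary∈ s (binaryProjections A) g∈Φ)
    ... | g′ , g′∈A , sameBinary = ∈ℙ⇒∈ (∈ℙ-fromParts g₀∈A g′∈A
      (λ j e → s⊆support j (proj₁ (∧-elim {big j} e)) (∈Φ⇒big⊆ s (binaryProjections A) g∈Φ j e))
      (select-injective binary sameBinary))

    A⊆Φ : ∀ {s} → (∀ j → big j ≡ true → support A j ≡ true → extend big s j ≡ true) →
      A ⊆ Φ s (binaryProjections A)
    A⊆Φ {s} support⊆s {g} g∈A = ∈Φ⁺ s (binaryProjections A)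
      (λ j e → let isBig , gj = ∧-elim {big j} e in support⊆s j isBig (any-intro (λ g → ℙ g j) g∈A gj))
      (∈binaryProjections⁺ g∈A)

    ≡Φ : A ∈ sublists 𝕊 → ∀ {s} → (∀ j → big j ≡ true → support A j ≡ extend big s j) →
      A ≡ Φ s (binaryProjections A)
    ≡Φ A∈ same = sublists-ext (UP.allFin⁺ _) A∈ (filter∈sublists _ 𝕊)
      (A⊆Φ (λ j isBig → subst (_≡ true) (same j isBig)))
      (Φ⊆A (λ j isBig → subst (_≡ true) (sym (same j isBig))))

  bigSupport : List (Idx n) → Vec Bool #big
  bigSupport A = select big (support A)

  closed≡Φ : ∀ {A} → A ∈ sublists 𝕊 → isClosed A ≡ true → A ≡ Φ (bigSupport A) (binaryProjections A)
  closed≡Φ {A} A∈ A-closed = ClosedCharacterisation.≡Φ A A-closed A∈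
    (λ j isBig → sym (trans (extend-select big (support A) j) (cong (_∧ support A j) isBig)))

  extend-binary∈Φ : ∀ s V {v} → v ∈ V → index (extend binary v) ∈ Φ s V
  extend-binary∈Φ s V {v} v∈V = ∈Φ⁺ s V noBig
    (subst (_∈ V) (sym (trans (select-index binary (extend binary v)) (select-extend binary v))) v∈V)
    where
    noBig : ∀ j → big j ∧ ℙ (index (extend binary v)) j ≡ true → extend big s j ≡ true
    noBig j e with ∧-elim {big j} e
    ... | isBig , vj with trans (sym isBig) (binary⇒¬big (extend-⊆ binary v j (trans (sym (inP-index _ j)) vj)))
    ...   | ()

  extend-big∈Φ : ∀ s V → isSubspace V ≡ true → index (extend big s) ∈ Φ s V
  extend-big∈Φ s V V-subspace = ∈Φ⁺ s V
    (λ j e → trans (sym (inP-index (extend big s) j)) (proj₂ (∧-elim {big j} e)))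
    (subst (_∈ V) (sym noBinary) (isSubspace⇒0∈ V-subspace))
    where
    noBinary : select binary (ℙ (index (extend big s))) ≡ V.replicate #binary false
    noBinary = trans (select-index binary (extend big s))
      (trans (select-cong binary (λ j isBinary → extend-outside big s j (binary⇒¬big isBinary)))
             (select-false binary))

  Φ-injective : ∀ s V s′ V′ → V ∈ sublists (allVecs #binary) → V′ ∈ sublists (allVecs #binary) →
    isSubspace V ≡ true → isSubspace V′ ≡ true → Φ s V ≡ Φ s′ V′ → s ≡ s′ × V ≡ V′
  Φ-injective s V s′ V′ V∈ V′∈ V-subspace V′-subspace Φ≡ = s≡s′ , V≡V′
    where
    open ≡-Reasoning
    V⊆ : ∀ s V s′ V′ → Φ s V ≡ Φ s′ V′ → V ⊆ V′
    V⊆ s V s′ V′ Φ≡ {v} v∈V =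
      subst (_∈ V′) (trans (select-index binary (extend binary v)) (select-extend binary v))
        (∈Φ⇒binary∈ s′ V′ (subst (index (extend binary v) ∈_) Φ≡ (extend-binary∈Φ s V v∈V)))
    s⊆ : ∀ s V s′ V′ → isSubspace V ≡ true → Φ s V ≡ Φ s′ V′ →
      ∀ j → extend big s j ≡ true → extend big s′ j ≡ true
    s⊆ s V s′ V′ V-subspace Φ≡ j sj =
      ∈Φ⇒big⊆ s′ V′ (subst (index (extend big s) ∈_) Φ≡ (extend-big∈Φ s V V-subspace)) j
        (∧-intro (extend-⊆ big s j sj) (trans (inP-index (extend big s) j) sj))
    s≡s′ : s ≡ s′
    s≡s′ = begin
      s                          ≡⟨ select-extend big s ⟨
      select big (extend big s)  ≡⟨ select-cong big (λ j _ → ≡true-antisym (s⊆ s V s′ V′ V-subspace Φ≡ j)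
                                                                           (s⊆ s′ V′ s V V′-subspace (sym Φ≡) j)) ⟩
      select big (extend big s′) ≡⟨ select-extend big s′ ⟩
      s′                         ∎
    V≡V′ : V ≡ V′
    V≡V′ = sublists-ext (allVecs-Unique #binary) V∈ V′∈ (V⊆ s V s′ V′ Φ≡) (V⊆ s′ V′ s V (sym Φ≡))

  subspaces : List (List (Vec Bool #binary))
  subspaces = filter (λ V → isSubspace V B.≟ true) (sublists (allVecs #binary))

  ∈subspaces⁻ : ∀ {V} → V ∈ subspaces → V ∈ sublists (allVecs #binary) × isSubspace V ≡ true
  ∈subspaces⁻ = MP.∈-filter⁻ (λ V → isSubspace V B.≟ true) {xs = sublists (allVecs #binary)}

  ∈subspaces⁺ : ∀ A → isSubspace (binaryProjections A) ≡ true → binaryProjections A ∈ subspaces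
  ∈subspaces⁺ A = MP.∈-filter⁺ (λ V → isSubspace V B.≟ true) (binaryProjections∈sublists A)

  subspaces-Unique : Unique subspaces
  subspaces-Unique = UP.filter⁺ _ (sublists-Unique (allVecs-Unique #binary))

  sublists𝕊-Unique : Unique (sublists 𝕊)
  sublists𝕊-Unique = sublists-Unique (UP.allFin⁺ _)

  closedSubsets : List (List (Idx n))
  closedSubsets = filter (λ A → isClosed A B.≟ true) (sublists 𝕊)

  parameters : List (Vec Bool #big × List (Vec Bool #binary))
  parameters = cartesianProduct (allVecs #big) subspaces

  closedSubsets⊆ : closedSubsets ⊆ map (uncurry Φ) parameters
  closedSubsets⊆ {A} A∈ with MP.∈-filter⁻ (λ A → isClosed A B.≟ true) {xs = sublists 𝕊} A∈
  ... | A∈sublists , A-closed = subst (_∈ map (uncurry Φ) parameters) (sym (closed≡Φ A∈sublists A-closed))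
    (MP.∈-map⁺ (uncurry Φ) (MP.∈-cartesianProduct⁺ (∈-allVecs (bigSupport A))
      (∈subspaces⁺ A (ClosedCharacterisation.binaryProjections-isSubspace A A-closed))))

  ⊆closedSubsets : map (uncurry Φ) parameters ⊆ closedSubsets
  ⊆closedSubsets A∈ with MP.∈-map⁻ (uncurry Φ) A∈
  ... | (s , V) , sV∈ , refl = MP.∈-filter⁺ (λ A → isClosed A B.≟ true) (filter∈sublists _ 𝕊)
    (Φ-isClosed s V (proj₂ (∈subspaces⁻ (proj₂ (MP.∈-cartesianProduct⁻ (allVecs #big) subspaces sV∈)))))

  Φ-Unique : Unique (map (uncurry Φ) parameters)
  Φ-Unique = map-Unique (uncurry Φ) (UP.cartesianProduct⁺ (allVecs-Unique #big) subspaces-Unique) injective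
    where
    injective : ∀ {x y} → x ∈ parameters → y ∈ parameters → uncurry Φ x ≡ uncurry Φ y → x ≡ y
    injective {s , V} {s′ , V′} x∈ y∈ Φ≡
      with ∈subspaces⁻ (proj₂ (MP.∈-cartesianProduct⁻ (allVecs #big) subspaces x∈))
         | ∈subspaces⁻ (proj₂ (MP.∈-cartesianProduct⁻ (allVecs #big) subspaces y∈))
    ... | V∈ , V-subspace | V′∈ , V′-subspace with Φ-injective s V s′ V′ V∈ V′∈ V-subspace V′-subspace Φ≡
    ...   | refl , refl = refl

  numClosed≡2^#big*G₂#binary : numClosed ≡ 2 ^ #big * G₂ #binary
  numClosed≡2^#big*G₂#binary = begin
    length closedSubsets
      ≡⟨ length-≡-⊆⊇ (UP.filter⁺ _ sublists𝕊-Unique) Φ-Unique closedSubsets⊆ ⊆closedSubsets ⟩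
    length (map (uncurry Φ) parameters)
      ≡⟨ LP.length-map (uncurry Φ) parameters ⟩
    length parameters
      ≡⟨ length-cartesianProduct (allVecs #big) subspaces ⟩
    length (allVecs #big) * length subspaces
      ≡⟨ cong (_* G₂ #binary) (length-allVecs #big) ⟩
    2 ^ #big * G₂ #binary ∎
    where open ≡-Reasoning

  allBig : Vec Bool #big
  allBig = select big (λ _ → true)

  Ψ : List (Vec Bool #binary) → List (Idx n)
  Ψ = Φ allBig

  extend-allBig : ∀ j → extend big allBig j ≡ big j
  extend-allBig j = trans (extend-select big (λ _ → true) j) (BP.∧-identityʳ (big j))

  isStronglyNormal⁻ : ∀ {A} → isStronglyNormal A ≡ true → ∀ g → prod (prod [ g ] A) [ g ] ⊆ A
  isStronglyNormal⁻ {A} e g = sub⇒⊆ (all-elim (λ g → sub (prod (prod [ g ] A) [ g ]) A)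
    (proj₂ (∧-elim {isClosed A} e)) (MP.∈-allFin g))

  stronglyNormal≡Ψ : ∀ {A} → A ∈ sublists 𝕊 → isStronglyNormal A ≡ true → A ≡ Ψ (binaryProjections A)
  stronglyNormal≡Ψ {A} A∈ A-normal = ≡Φ A∈ λ j isBig →
    trans (any-intro (λ g → ℙ g j) allBig∈A (trans (inP-index big j) isBig))
          (sym (trans (extend-allBig j) isBig))
    where
    A-closed : isClosed A ≡ true
    A-closed = proj₁ (∧-elim {isClosed A} A-normal)
    open ClosedCharacterisation A A-closed
    open ClosedSubset A (isClosed⇒ProductClosed A-closed)
    -- R_big ∈ R_big R_0 R_big, and R_0 ∈ A.
    allBig∈A : index big ∈ A
    allBig∈A = isStronglyNormal⁻ A-normal (index big)
      (∈-prod⁺ {prod [ index big ] A} {[ index big ]}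
        (∈-prod⁺ {[ index big ]} {A} (here refl) (0∈ g₀∈A)
          (Composable-index (λ j → composable-identityʳ (big j) (big j))))
               (here refl) (Composable-index (λ j → composable-diagonal (big j))))

  Ψ-isStronglyNormal : ∀ V → isSubspace V ≡ true → isStronglyNormal (Ψ V) ≡ true
  Ψ-isStronglyNormal V V-subspace =
    ∧-intro (Φ-isClosed allBig V V-subspace) (all-intro _ 𝕊 (λ {g} _ → ⊆⇒sub (conjugate⊆ g)))
    where
    conjugate⊆ : ∀ g → prod (prod [ g ] (Ψ V)) [ g ] ⊆ Ψ V
    conjugate⊆ g {x} x∈ with ∈-prod⁻ {prod [ g ] (Ψ V)} {[ g ]} x∈
    ... | b , _ , b∈ , here refl , comp₁ with ∈-prod⁻ {[ g ]} {Ψ V} b∈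
    ...   | _ , c , here refl , c∈Ψ , comp₂ = ∈Φ⁺ allBig V
      (λ j e → trans (extend-allBig j) (proj₁ (∧-elim {big j} e)))
      (subst (_∈ V) (select-cong binary binaryPart≡) (∈Φ⇒binary∈ allBig V c∈Ψ))
      where
      binaryPart≡ : ∀ j → binary j ≡ true → ℙ c j ≡ ℙ x j
      binaryPart≡ j isBinary = sym (begin
        ℙ x j                       ≡⟨ Composable-binary⁻ (ℙ b) (ℙ g) (ℙ x) comp₁ j isBinary ⟩
        ℙ b j xor ℙ g j             ≡⟨ cong (_xor ℙ g j) (Composable-binary⁻ (ℙ g) (ℙ c) (ℙ b) comp₂ j isBinary) ⟩
        (ℙ g j xor ℙ c j) xor ℙ g j ≡⟨ cong (_xor ℙ g j) (BP.xor-comm (ℙ g j) (ℙ c j)) ⟩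
        (ℙ c j xor ℙ g j) xor ℙ g j ≡⟨ BP.xor-assoc (ℙ c j) (ℙ g j) (ℙ g j) ⟩
        ℙ c j xor (ℙ g j xor ℙ g j) ≡⟨ cong (ℙ c j xor_) (BP.xor-same (ℙ g j)) ⟩
        ℙ c j xor false             ≡⟨ BP.xor-identityʳ (ℙ c j) ⟩
        ℙ c j                       ∎)
        where open ≡-Reasoning

  stronglyNormalSubsets : List (List (Idx n))
  stronglyNormalSubsets = filter (λ A → isStronglyNormal A B.≟ true) (sublists 𝕊)

  stronglyNormalSubsets⊆ : stronglyNormalSubsets ⊆ map Ψ subspaces
  stronglyNormalSubsets⊆ {A} A∈ with MP.∈-filter⁻ (λ A → isStronglyNormal A B.≟ true) {xs = sublists 𝕊} A∈
  ... | A∈sublists , A-normal = subst (_∈ map Ψ subspaces) (sym (stronglyNormal≡Ψ A∈sublists A-normal))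
    (MP.∈-map⁺ Ψ (∈subspaces⁺ A
      (ClosedCharacterisation.binaryProjections-isSubspace A (proj₁ (∧-elim {isClosed A} A-normal)))))

  ⊆stronglyNormalSubsets : map Ψ subspaces ⊆ stronglyNormalSubsets
  ⊆stronglyNormalSubsets A∈ with MP.∈-map⁻ Ψ A∈
  ... | V , V∈ , refl = MP.∈-filter⁺ (λ A → isStronglyNormal A B.≟ true) (filter∈sublists _ 𝕊)
    (Ψ-isStronglyNormal V (proj₂ (∈subspaces⁻ V∈)))

  Ψ-Unique : Unique (map Ψ subspaces)
  Ψ-Unique = map-Unique Ψ subspaces-Unique λ {V} {V′} V∈ V′∈ Ψ≡ →
    let V∈sublists , V-subspace = ∈subspaces⁻ V∈
        V′∈sublists , V′-subspace = ∈subspaces⁻ V′∈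
    in proj₂ (Φ-injective allBig V allBig V′ V∈sublists V′∈sublists V-subspace V′-subspace Ψ≡)

  numStronglyNormal≡G₂#binary : numStronglyNormal ≡ G₂ #binary
  numStronglyNormal≡G₂#binary =
    trans (length-≡-⊆⊇ (UP.filter⁺ _ sublists𝕊-Unique) Ψ-Unique stronglyNormalSubsets⊆ ⊆stronglyNormalSubsets)
          (LP.length-map Ψ subspaces)

  Oϑ : List (Idx n)
  Oϑ = filter (λ g → (k g ≡ᵇ 1) B.≟ true) 𝕊

  binaryRelations : List (Idx n)
  binaryRelations = map (index ∘ extend binary) (allVecs #binary)

  Oϑ⊆ : Oϑ ⊆ binaryRelations
  Oϑ⊆ {g} g∈ =
    subst (_∈ binaryRelations) g≡ (MP.∈-map⁺ (index ∘ extend binary) (∈-allVecs (select binary (ℙ g))))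
    where
    g⊆binary : ∀ j → ℙ g j ≡ true → binary j ≡ true
    g⊆binary j = ⇒-elim (every-elim n (trans (sym (k≡ᵇ1 g))
      (proj₂ (MP.∈-filter⁻ (λ g → (k g ≡ᵇ 1) B.≟ true) {xs = 𝕊} g∈))) j)
    g≡ : index (extend binary (select binary (ℙ g))) ≡ g
    g≡ = trans (index-cong (λ j → trans (extend-select binary (ℙ g) j)
                                        (≡true-antisym (proj₂ ∘ ∧-elim {binary j}) (λ gj → ∧-intro (g⊆binary j gj) gj))))
               (index-inP {n} g)

  ⊆Oϑ : binaryRelations ⊆ Oϑ
  ⊆Oϑ g∈ with MP.∈-map⁻ (index ∘ extend binary) g∈
  ... | v , _ , refl = MP.∈-filter⁺ (λ g → (k g ≡ᵇ 1) B.≟ true) (MP.∈-allFin _)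
    (trans (k≡ᵇ1 (index (extend binary v))) (every-intro n (λ j → ⇒-intro λ vj →
      extend-⊆ binary v j (trans (sym (inP-index (extend binary v) j)) vj))))

  binaryRelations-Unique : Unique binaryRelations
  binaryRelations-Unique = UP.map⁺ injective (allVecs-Unique #binary)
    where
    injective : ∀ {v w} → index (extend binary v) ≡ index (extend binary w) → v ≡ w
    injective {v} {w} e = begin
      v                                           ≡⟨ select-extend binary v ⟨
      select binary (extend binary v)             ≡⟨ select-index binary (extend binary v) ⟨
      select binary (ℙ (index (extend binary v))) ≡⟨ cong (select binary ∘ ℙ) e ⟩
      select binary (ℙ (index (extend binary w))) ≡⟨ select-index binary (extend binary w) ⟩
      select binary (extend binary w)             ≡⟨ select-extend binary w ⟩
      w                                           ∎
      where open ≡-Reasoning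

  d₁≡2^#binary : d₁ ≡ 2 ^ #binary
  d₁≡2^#binary = begin
    length Oϑ               ≡⟨ length-≡-⊆⊇ (UP.filter⁺ _ (UP.allFin⁺ _)) binaryRelations-Unique Oϑ⊆ ⊆Oϑ ⟩
    length binaryRelations  ≡⟨ LP.length-map (index ∘ extend binary) (allVecs #binary) ⟩
    length (allVecs #binary) ≡⟨ length-allVecs #binary ⟩
    2 ^ #binary             ∎
    where open ≡-Reasoning

  n₂≡#big : n₂ ≡ #big
  n₂≡#big = countL-allFin big

theorem3p22 : (n : ℕ) → 1 ≤ n → (u : Fin n → ℕ) → (h : (a : Fin n) → 2 ≤ u a) →
    (Scheme.numClosed n u h ≡ 2 ^ Scheme.n₂ n u h * G₂ ⌊log₂ Scheme.d₁ n u h ⌋)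
    × (Scheme.numStronglyNormal n u h ≡ G₂ ⌊log₂ Scheme.d₁ n u h ⌋)
theorem3p22 n _ u h =
  trans numClosed≡2^#big*G₂#binary (sym (cong₂ (λ a b → 2 ^ a * G₂ b) n₂≡#big log₂d₁≡#binary)) ,
  trans numStronglyNormal≡G₂#binary (sym (cong G₂ log₂d₁≡#binary))
  where
  open Scheme n u h
  open FactorialScheme n u h
  log₂d₁≡#binary : ⌊log₂ d₁ ⌋ ≡ #binary
  log₂d₁≡#binary = trans (cong ⌊log₂_⌋ d₁≡2^#binary) (⌊log₂[2^n]⌋≡n #binary)
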